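{- For any nonnegative integers $b,c,n$ with $0\le c\le b-2n$, $$\sum_{a=0}^{n}\binom{2a}{a}\binom{b-2a}{n-a}=\sum_{a=0}^{n}\binom{2a+c}{a}\binom{b-c-2a}{n-a}.$$ -}

module Defs where

open import Data.Nat using (ℕ; zero; suc; _+_)

sumTo : ℕ → (ℕ → ℕ) → ℕ
sumTo zero    f = f 0
sumTo (suc n) f = sumTo n f + f (suc n)

-- Write S c m n for Σ_{a ≤ n} C(2a + c, a) C(m − 2a, n − a); the theorem says S 0 (c + m) n = S c m n
-- whenever 2n ≤ m.  It suffices to move one unit from m to c, i.e. S c (m + 1) n = S (c + 1) m n.
-- Pascal's rule applied to the second factor splits the left side as S c m n + S c m (n − 1), and applied
-- to the first factor splits the right side as S c m n + S (c + 2) (m − 2) (n − 1); the remaining terms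
-- agree by induction on n, moving two units from m to c.
module Submission where

open import Defs
open import Data.Nat using (ℕ; zero; suc; _+_; _*_; _∸_; _≤_; z≤n)
open import Data.Nat.Properties
open import Data.Nat.Combinatorics using (_C_; nCk+nC[k+1]≡[n+1]C[k+1])
open import Algebra.Properties.CommutativeSemigroup +-commutativeSemigroup using (interchange; xy∙z≈xz∙y)
open import Relation.Binary.PropositionalEquality

sumTo-cong : ∀ n {f g : ℕ → ℕ} → (∀ a → a ≤ n → f a ≡ g a) → sumTo n f ≡ sumTo n g
sumTo-cong zero    f≗g = f≗g 0 z≤n
sumTo-cong (suc n) f≗g =
  cong₂ _+_ (sumTo-cong n (λ a a≤n → f≗g a (m≤n⇒m≤1+n a≤n))) (f≗g (suc n) ≤-refl)

sumTo-+ : ∀ n (f g : ℕ → ℕ) → sumTo n (λ a → f a + g a) ≡ sumTo n f + sumTo n g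
sumTo-+ zero    f g = refl
sumTo-+ (suc n) f g = begin
  sumTo n (λ a → f a + g a) + (f (suc n) + g (suc n))
    ≡⟨ cong (_+ (f (suc n) + g (suc n))) (sumTo-+ n f g) ⟩
  sumTo n f + sumTo n g + (f (suc n) + g (suc n))
    ≡⟨ interchange (sumTo n f) (sumTo n g) (f (suc n)) (g (suc n)) ⟩
  sumTo n f + f (suc n) + (sumTo n g + g (suc n))
    ∎
  where open ≡-Reasoning

sumTo-suc : ∀ n (f : ℕ → ℕ) → sumTo (suc n) f ≡ f 0 + sumTo n (λ a → f (suc a))
sumTo-suc zero    f = refl
sumTo-suc (suc n) f = trans (cong (_+ f (2 + n)) (sumTo-suc n f)) (+-assoc (f 0) _ _)

pascal-∸ : ∀ {i m j n} → i ≤ m → j ≤ n →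
           (suc m ∸ i) C (suc n ∸ j) ≡ (m ∸ i) C (suc n ∸ j) + (m ∸ i) C (n ∸ j)
pascal-∸ {i} {m} {j} {n} i≤m j≤n
  rewrite +-∸-assoc 1 i≤m | +-∸-assoc 1 j≤n
  = trans (sym (nCk+nC[k+1]≡[n+1]C[k+1] (m ∸ i) (n ∸ j))) (+-comm ((m ∸ i) C (n ∸ j)) _)

pascal-central : ∀ c a →
  (2 * suc a + suc c) C suc a ≡ (2 * suc a + c) C suc a + (2 * a + (2 + c)) C a
pascal-central c a = begin
  (2 * suc a + suc c) C suc a
    ≡⟨ cong (_C suc a) 2[1+a]+[1+c]≡1+2a+[2+c] ⟩
  suc (2 * a + (2 + c)) C suc a
    ≡⟨ sym (nCk+nC[k+1]≡[n+1]C[k+1] (2 * a + (2 + c)) a) ⟩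
  (2 * a + (2 + c)) C a + (2 * a + (2 + c)) C suc a
    ≡⟨ +-comm ((2 * a + (2 + c)) C a) _ ⟩
  (2 * a + (2 + c)) C suc a + (2 * a + (2 + c)) C a
    ≡⟨ cong (λ k → k C suc a + (2 * a + (2 + c)) C a) (sym 2[1+a]+c≡2a+[2+c]) ⟩
  (2 * suc a + c) C suc a + (2 * a + (2 + c)) C a
    ∎
  where
  open ≡-Reasoning
  2[1+a]+c≡2a+[2+c] : 2 * suc a + c ≡ 2 * a + (2 + c)
  2[1+a]+c≡2a+[2+c] = trans (cong (_+ c) (trans (*-suc 2 a) (+-comm 2 (2 * a)))) (+-assoc (2 * a) 2 c)
  2[1+a]+[1+c]≡1+2a+[2+c] : 2 * suc a + suc c ≡ suc (2 * a + (2 + c))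
  2[1+a]+[1+c]≡1+2a+[2+c] = trans (+-suc (2 * suc a) c) (cong suc 2[1+a]+c≡2a+[2+c])

nC[k∸k]≡1 : ∀ n k → n C (k ∸ k) ≡ 1
nC[k∸k]≡1 n k rewrite n∸n≡0 k = refl

S : ℕ → ℕ → ℕ → ℕ
S c m n = sumTo n (λ a → ((2 * a + c) C a) * ((m ∸ 2 * a) C (n ∸ a)))

S-pascalᵐ : ∀ c m n → 2 * n ≤ m → S c (suc m) (suc n) ≡ S c m (suc n) + S c m n
S-pascalᵐ c m n 2n≤m = begin
  S c (suc m) (suc n)
    ≡⟨ cong₂ _+_ (sumTo-cong n split) (cong (A (suc n) *_) (nC[k∸k]≡1 _ n)) ⟩
  sumTo n (λ a → A a * P (suc n) a + A a * P n a) + A (suc n) * 1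
    ≡⟨ cong (_+ A (suc n) * 1) (sumTo-+ n _ _) ⟩
  sumTo n (λ a → A a * P (suc n) a) + S c m n + A (suc n) * 1
    ≡⟨ xy∙z≈xz∙y (sumTo n (λ a → A a * P (suc n) a)) (S c m n) (A (suc n) * 1) ⟩
  sumTo n (λ a → A a * P (suc n) a) + A (suc n) * 1 + S c m n
    ≡⟨ cong (λ t → sumTo n (λ a → A a * P (suc n) a) + A (suc n) * t + S c m n) (sym (nC[k∸k]≡1 _ n)) ⟩
  S c m (suc n) + S c m n
    ∎
  where
  open ≡-Reasoning
  A : ℕ → ℕ
  A a = (2 * a + c) C a
  P : ℕ → ℕ → ℕ
  P k a = (m ∸ 2 * a) C (k ∸ a)
  split : ∀ a → a ≤ n → A a * ((suc m ∸ 2 * a) C (suc n ∸ a)) ≡ A a * P (suc n) a + A a * P n a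
  split a a≤n = trans (cong (A a *_) (pascal-∸ (≤-trans (*-monoʳ-≤ 2 a≤n) 2n≤m) a≤n))
                      (*-distribˡ-+ (A a) _ _)

S-pascalᶜ : ∀ c m n → S (suc c) m (suc n) ≡ S c m (suc n) + S (2 + c) (m ∸ 2) n
S-pascalᶜ c m n = begin
  S (suc c) m (suc n)
    ≡⟨ sumTo-suc n _ ⟩
  B 0 * P 0 + sumTo n (λ a → B (suc a) * P (suc a))
    ≡⟨ cong (B 0 * P 0 +_) (sumTo-cong n (λ a _ → split a)) ⟩
  B 0 * P 0 + sumTo n (λ a → A (suc a) * P (suc a) + D a * ((m ∸ 2 ∸ 2 * a) C (n ∸ a)))
    ≡⟨ cong (B 0 * P 0 +_) (sumTo-+ n _ _) ⟩
  B 0 * P 0 + (sumTo n (λ a → A (suc a) * P (suc a)) + S (2 + c) (m ∸ 2) n)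
    ≡⟨ sym (+-assoc (B 0 * P 0) _ _) ⟩
  B 0 * P 0 + sumTo n (λ a → A (suc a) * P (suc a)) + S (2 + c) (m ∸ 2) n
    ≡⟨ cong (_+ S (2 + c) (m ∸ 2) n) (sym (sumTo-suc n _)) ⟩
  S c m (suc n) + S (2 + c) (m ∸ 2) n
    ∎
  where
  open ≡-Reasoning
  A B D : ℕ → ℕ
  A a = (2 * a + c) C a
  B a = (2 * a + suc c) C a
  D a = (2 * a + (2 + c)) C a
  P : ℕ → ℕ
  P a = (m ∸ 2 * a) C (suc n ∸ a)
  split : ∀ a → B (suc a) * P (suc a) ≡ A (suc a) * P (suc a) + D a * ((m ∸ 2 ∸ 2 * a) C (n ∸ a))
  split a = begin
    B (suc a) * P (suc a)
      ≡⟨ cong (_* P (suc a)) (pascal-central c a) ⟩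
    (A (suc a) + D a) * P (suc a)
      ≡⟨ *-distribʳ-+ (P (suc a)) (A (suc a)) (D a) ⟩
    A (suc a) * P (suc a) + D a * P (suc a)
      ≡⟨ cong (λ k → A (suc a) * P (suc a) + D a * (k C (n ∸ a)))
              (trans (cong (m ∸_) (*-suc 2 a)) (sym (∸-+-assoc m 2 (2 * a)))) ⟩
    A (suc a) * P (suc a) + D a * ((m ∸ 2 ∸ 2 * a) C (n ∸ a))
      ∎

S-2[1+a]+[1+c]≡1+2a+[2+c] : ∀ c m n → 2 * n ≤ m → S c (suc m) n ≡ S (suc c) m n
S-2[1+a]+[1+c]≡1+2a+[2+c] c m             zero    _   = refl
S-2[1+a]+[1+c]≡1+2a+[2+c] c (suc (suc m)) (suc n) 2n+2≤m+2 = begin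
  S c (3 + m) (suc n)
    ≡⟨ S-pascalᵐ c (2 + m) n (m≤n⇒m≤1+n (m≤n⇒m≤1+n 2n≤m)) ⟩
  S c (2 + m) (suc n) + S c (2 + m) n
    ≡⟨ cong (S c (2 + m) (suc n) +_)
            (trans (S-2[1+a]+[1+c]≡1+2a+[2+c] c (suc m) n (m≤n⇒m≤1+n 2n≤m)) (S-2[1+a]+[1+c]≡1+2a+[2+c] (suc c) m n 2n≤m)) ⟩
  S c (2 + m) (suc n) + S (2 + c) m n
    ≡⟨ sym (S-pascalᶜ c (2 + m) n) ⟩
  S (suc c) (2 + m) (suc n)
    ∎
  where
  open ≡-Reasoning
  2n≤m : 2 * n ≤ m
  2n≤m = ≤-pred (≤-pred (subst (_≤ 2 + m) (*-suc 2 n) 2n+2≤m+2))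
S-2[1+a]+[1+c]≡1+2a+[2+c] c zero          (suc n) ()
S-2[1+a]+[1+c]≡1+2a+[2+c] c (suc zero)    (suc n) 2n+2≤1 with () ← ≤-pred (subst (_≤ 1) (*-suc 2 n) 2n+2≤1)

S-2[1+a]+[1+c]≡1+2a+[2+c]* : ∀ c m n → 2 * n ≤ m → S 0 (c + m) n ≡ S c m n
S-2[1+a]+[1+c]≡1+2a+[2+c]* zero    m n _    = refl
S-2[1+a]+[1+c]≡1+2a+[2+c]* (suc c) m n 2n≤m = begin
  S 0 (suc c + m) n   ≡⟨ cong (λ k → S 0 k n) (sym (+-suc c m)) ⟩
  S 0 (c + suc m) n   ≡⟨ S-2[1+a]+[1+c]≡1+2a+[2+c]* c (suc m) n (m≤n⇒m≤1+n 2n≤m) ⟩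
  S c (suc m) n       ≡⟨ S-2[1+a]+[1+c]≡1+2a+[2+c] c m n 2n≤m ⟩
  S (suc c) m n       ∎
  where open ≡-Reasoning

lemma6p4 : (b c n : ℕ) → c + 2 * n ≤ b →
    sumTo n (λ a → ((2 * a) C a) * ((b ∸ 2 * a) C (n ∸ a)))
      ≡ sumTo n (λ a → ((2 * a + c) C a) * ((b ∸ c ∸ 2 * a) C (n ∸ a)))
lemma6p4 b c n c+2n≤b = begin
  sumTo n (λ a → ((2 * a) C a) * ((b ∸ 2 * a) C (n ∸ a)))
    ≡⟨ sumTo-cong n (λ a _ → cong (λ k → (k C a) * ((b ∸ 2 * a) C (n ∸ a))) (sym (+-identityʳ (2 * a)))) ⟩
  S 0 b n
    ≡⟨ cong (λ k → S 0 k n) (sym (m+[n∸m]≡n (≤-trans (m≤m+n c (2 * n)) c+2n≤b))) ⟩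
  S 0 (c + (b ∸ c)) n
    ≡⟨ S-2[1+a]+[1+c]≡1+2a+[2+c]* c (b ∸ c) n (subst (_≤ b ∸ c) (m+n∸m≡n c (2 * n)) (∸-monoˡ-≤ c c+2n≤b)) ⟩
  S c (b ∸ c) n
    ∎
  where open ≡-Reasoning
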